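{- Let $n_1,n_2$ be nonnegative integers and $z_1,z_2\in\mathbb{C}$. Then \[ \zeta_2(-n_1,-n_2;z_1+1,z_2)=\zeta_2(-n_1,-n_2;z_1,z_2)+\frac{(-1)^{n_1+n_2}}{n_2+1}\,z_1^{n_1}\,B_{n_2+1}(z_1+z_2). \]
   Context: Bernoulli numbers $B_m$ are defined by $\frac{t}{e^t-1}=\sum_{m\ge0}B_m\frac{t^m}{m!}$. Bernoulli polynomials are $B_m(z)=\sum_{j=0}^m\binom{m}{j}B_jz^{m-j}$. The depth-2 shifted multiple zeta value at negative integers (the paper's symbolic form of Sadaoui's analytic continuation, $(-1)^{n_1+n_2}\mathcal{C}_1^{n_1+1}(z_1)\mathcal{C}_{1,2}^{n_2+1}(z_1,z_2)$) is explicitly \[ \zeta_2(-n_1,-n_2;z_1,z_2)=\frac{(-1)^{n_1+n_2}}{n_2+1}\sum_{k=0}^{n_2+1}\binom{n_2+1}{k}\frac{B_{n_1+1+k}(z_1)}{n_1+1+k}\,B_{n_2+1-k}(z_2). \] -}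

module Defs where

open import Level using (Level; _⊔_)
open import Data.Nat as ℕ using (ℕ; zero; suc; _∸_)
open import Data.Nat.Combinatorics using (_C_)
open import Data.Integer as ℤ using (ℤ; +_)
open import Data.Rational as ℚ using (ℚ; 0ℚ; 1ℚ)
open import Data.Fin using (Fin; toℕ; fromℕ)
open import Data.Vec as Vec using (Vec; []; _∷_; lookup; _∷ʳ_)
open import Data.List as List using (List; upTo; foldr; map)
open import Algebra.Bundles using (CommutativeRing)
open import Algebra.Morphism.Structures using (IsRingHomomorphism)

-- Bernoulli numbers B_m (convention t/(e^t - 1), so B_1 = -1/2),
-- computed by the recurrence obtained by comparing coefficients in
-- t = (e^t - 1) Σ B_m t^m/m! :
--   B_0 = 1,   Σ_{j=0}^{m} C(m+1,j) B_j = 0  (m ≥ 1).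

ℕ→ℚ : ℕ → ℚ
ℕ→ℚ n = (+ n) ℚ./ 1

sumℚ : List ℚ → ℚ
sumℚ = foldr ℚ._+_ 0ℚ

nextB : (k : ℕ) → Vec ℚ (suc k) → ℚ
nextB k v = ℚ.- ((+ 1 ℚ./ suc (suc k)) ℚ.*
  sumℚ (List.map (λ j → ℕ→ℚ (suc (suc k) C toℕ j) ℚ.* lookup v j)
                 (List.allFin (suc k))))

Bs : (m : ℕ) → Vec ℚ (suc m)
Bs zero    = 1ℚ ∷ []
Bs (suc m) = Bs m ∷ʳ nextB m (Bs m)

bernoulli : ℕ → ℚ
bernoulli m = lookup (Bs m) (fromℕ m)

-- Everything below lives in a commutative ℚ-algebra R (a commutative
-- ring with a ring homomorphism ι : ℚ → R); ℂ is the intended instance.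

module QAlgebra {c ℓ : Level} (R : CommutativeRing c ℓ)
                (ι : ℚ → CommutativeRing.Carrier R)
                (ι-hom : IsRingHomomorphism ℚ.+-*-rawRing (CommutativeRing.rawRing R) ι)
                where
  open CommutativeRing R

  pow : Carrier → ℕ → Carrier
  pow z zero    = 1#
  pow z (suc n) = z * pow z n

  Σ< : ℕ → (ℕ → Carrier) → Carrier
  Σ< n f = foldr _+_ 0# (List.map f (upTo n))

  sgn : ℕ → Carrier
  sgn n = pow (- 1#) n

  inv1+ : ℕ → Carrier
  inv1+ n = ι (+ 1 ℚ./ suc n)

  binom : ℕ → ℕ → Carrier
  binom n k = ι (ℕ→ℚ (n C k))

  bernoulliPoly : ℕ → Carrier → Carrier
  bernoulliPoly m z = Σ< (suc m) (λ j → binom m j * ι (bernoulli j) * pow z (m ∸ j))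

  zeta2 : ℕ → ℕ → Carrier → Carrier → Carrier
  zeta2 n₁ n₂ z₁ z₂ =
    sgn (n₁ ℕ.+ n₂) * inv1+ n₂ *
    Σ< (suc (suc n₂)) (λ k →
      binom (suc n₂) k * (bernoulliPoly (suc n₁ ℕ.+ k) z₁ * inv1+ (n₁ ℕ.+ k))
        * bernoulliPoly (suc n₂ ∸ k) z₂)

{-# OPTIONS --safe #-}
module Submission where

-- Write A_m(a; z) = Σ_j C(m,j) a_j z^{m-j}.  Then B_m(z) = A_m(β; z) with β_j = B_j, and
-- A satisfies the addition law A_m(a; x + y) = A_m(j ↦ A_j(a; y); x).  The Bernoulli
-- recurrence says A_k(β; 1) = B_k + [k = 1], so B_{n+1}(z + 1) = B_{n+1}(z) + (n+1) z^n.
-- Inserting this in each term of ζ₂(-n₁,-n₂; z₁ + 1, z₂) splits off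
-- z₁^{n₁} Σ_k C(n₂+1,k) z₁^k B_{n₂+1-k}(z₂), which the addition law sums to
-- z₁^{n₁} B_{n₂+1}(z₁ + z₂).

open import Defs
open import Level using (Level)
open import Function using (_∘_)
open import Data.Bool using (false)
open import Data.Nat using (ℕ; zero; suc; _∸_; _<_; z≤n; s≤s; s≤s⁻¹)
import Data.Nat as ℕ
import Data.Nat.Properties as ℕP
open import Data.Nat.Combinatorics
  using (_C_; nCk+nC[k+1]≡[n+1]C[k+1]; nCn≡1; nCk≡nC[n∸k]; nC1≡n)
open import Data.Integer as ℤ using (+_)
import Data.Integer.Properties as ℤP
open import Data.Rational as ℚ using (ℚ; 1ℚ)
import Data.Rational.Properties as ℚP
open import Data.Rational.Unnormalised as ℚᵘ using (mkℚᵘ; *≡*)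
import Data.Rational.Unnormalised.Properties as ℚᵘP
open import Data.Fin as Fin using (Fin; toℕ; fromℕ; inject₁)
import Data.Fin.Properties as FinP
open import Data.Fin.Relation.Unary.Top using (view; ‵fromℕ; ‵inject₁)
open import Data.Vec using (Vec; []; _∷_; lookup; _∷ʳ_)
import Data.List as List
import Data.List.Properties as ListP
open import Algebra.Bundles using (CommutativeRing)
open import Algebra.Morphism.Structures using (IsRingHomomorphism)
open import Relation.Binary.PropositionalEquality as ≡ using (_≡_)

toℚᵘ-ℕ→ℚ : ∀ n → ℚ.toℚᵘ (ℕ→ℚ n) ℚᵘ.≃ mkℚᵘ (+ n) 0
toℚᵘ-ℕ→ℚ n = ℚP.toℚᵘ-fromℚᵘ (mkℚᵘ (+ n) 0)

ℕ→ℚ-+ : ∀ m n → ℕ→ℚ (m ℕ.+ n) ≡ ℕ→ℚ m ℚ.+ ℕ→ℚ n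
ℕ→ℚ-+ m n = ℚP.toℚᵘ-injective (begin
  ℚ.toℚᵘ (ℕ→ℚ (m ℕ.+ n))              ≈⟨ toℚᵘ-ℕ→ℚ (m ℕ.+ n) ⟩
  mkℚᵘ (+ (m ℕ.+ n)) 0                ≈⟨ *≡* (≡.cong (ℤ._* + 1) numerators) ⟩
  mkℚᵘ (+ m) 0 ℚᵘ.+ mkℚᵘ (+ n) 0      ≈⟨ ℚᵘP.+-cong (toℚᵘ-ℕ→ℚ m) (toℚᵘ-ℕ→ℚ n) ⟨
  ℚ.toℚᵘ (ℕ→ℚ m) ℚᵘ.+ ℚ.toℚᵘ (ℕ→ℚ n)  ≈⟨ ℚP.toℚᵘ-homo-+ (ℕ→ℚ m) (ℕ→ℚ n) ⟨
  ℚ.toℚᵘ (ℕ→ℚ m ℚ.+ ℕ→ℚ n)            ∎)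
  where
  open ℚᵘP.≃-Reasoning
  numerators : + (m ℕ.+ n) ≡ + m ℤ.* + 1 ℤ.+ + n ℤ.* + 1
  numerators = ≡.trans (ℤP.pos-+ m n)
    (≡.sym (≡.cong₂ ℤ._+_ (ℤP.*-identityʳ (+ m)) (ℤP.*-identityʳ (+ n))))

ℕ→ℚ-*-inverse : ∀ n → ℕ→ℚ (suc n) ℚ.* (+ 1 ℚ./ suc n) ≡ 1ℚ
ℕ→ℚ-*-inverse n = ℚP.toℚᵘ-injective (begin
  ℚ.toℚᵘ (ℕ→ℚ (suc n) ℚ.* (+ 1 ℚ./ suc n))
    ≈⟨ ℚP.toℚᵘ-homo-* (ℕ→ℚ (suc n)) (+ 1 ℚ./ suc n) ⟩
  ℚ.toℚᵘ (ℕ→ℚ (suc n)) ℚᵘ.* ℚ.toℚᵘ (+ 1 ℚ./ suc n)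
    ≈⟨ ℚᵘP.*-cong (toℚᵘ-ℕ→ℚ (suc n)) (ℚP.toℚᵘ-fromℚᵘ (mkℚᵘ (+ 1) n)) ⟩
  mkℚᵘ (+ suc n) 0 ℚᵘ.* mkℚᵘ (+ 1) n
    ≈⟨ *≡* (≡.cong (+_ ∘ suc) cross) ⟩
  ℚᵘ.1ℚᵘ
    ∎)
  where
  open ℚᵘP.≃-Reasoning
  cross : (n ℕ.* 1) ℕ.* 1 ≡ (n ℕ.+ 0) ℕ.+ 0
  cross = ≡.trans (ℕP.*-identityʳ (n ℕ.* 1)) (≡.trans (ℕP.*-identityʳ n)
    (≡.sym (≡.trans (ℕP.+-identityʳ (n ℕ.+ 0)) (ℕP.+-identityʳ n))))

n<ᵇn≡false : ∀ n → (n ℕ.<ᵇ n) ≡ false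
n<ᵇn≡false zero    = ≡.refl
n<ᵇn≡false (suc n) = n<ᵇn≡false n

nC[1+n]≡0 : ∀ n → n C suc n ≡ 0
nC[1+n]≡0 n rewrite n<ᵇn≡false n = ≡.refl

[1+n]Cn≡1+n : ∀ n → suc n C n ≡ suc n
[1+n]Cn≡1+n n = ≡.trans (nCk≡nC[n∸k] (ℕP.n≤1+n n))
  (≡.trans (≡.cong (suc n C_) (ℕP.m+n∸n≡m 1 n)) (nC1≡n (suc n)))

lookup-∷ʳ-inject₁ : ∀ {a} {A : Set a} {n} (xs : Vec A n) (x : A) (j : Fin n) →
                    lookup (xs ∷ʳ x) (inject₁ j) ≡ lookup xs j
lookup-∷ʳ-inject₁ (y ∷ xs) x Fin.zero    = ≡.refl
lookup-∷ʳ-inject₁ (y ∷ xs) x (Fin.suc j) = lookup-∷ʳ-inject₁ xs x j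

lookup-∷ʳ-fromℕ : ∀ {a} {A : Set a} {n} (xs : Vec A n) (x : A) → lookup (xs ∷ʳ x) (fromℕ n) ≡ x
lookup-∷ʳ-fromℕ []       x = ≡.refl
lookup-∷ʳ-fromℕ (y ∷ xs) x = lookup-∷ʳ-fromℕ xs x

lookup-Bs : ∀ m (j : Fin (suc m)) → lookup (Bs m) j ≡ bernoulli (toℕ j)
lookup-Bs zero    Fin.zero = ≡.refl
lookup-Bs (suc m) j with view j
... | ‵fromℕ     = ≡.cong bernoulli (≡.sym (FinP.toℕ-fromℕ (suc m)))
... | ‵inject₁ i = ≡.trans (lookup-∷ʳ-inject₁ (Bs m) _ i)
                     (≡.trans (lookup-Bs m i) (≡.cong bernoulli (≡.sym (FinP.toℕ-inject₁ i))))

bernoulli-suc : ∀ k → bernoulli (suc k) ≡ nextB k (Bs k)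
bernoulli-suc k = lookup-∷ʳ-fromℕ (Bs k) _

module QAlgebraProperties {c ℓ : Level} (R : CommutativeRing c ℓ)
  (ι : ℚ → CommutativeRing.Carrier R)
  (ι-hom : IsRingHomomorphism ℚ.+-*-rawRing (CommutativeRing.rawRing R) ι) where

  open CommutativeRing R
  open QAlgebra R ι ι-hom
  open IsRingHomomorphism ι-hom using (+-homo; *-homo; 1#-homo; 0#-homo; -‿homo)
  open import Algebra.Properties.Ring ring using (-‿distribʳ-*)
  open import Algebra.Properties.CommutativeSemigroup +-commutativeSemigroup
    using () renaming (interchange to +-interchange; x∙yz≈xz∙y to x+[y+z]≈[x+z]+y)
  open import Algebra.Properties.CommutativeSemigroup *-commutativeSemigroup
    using () renaming (xy∙z≈xz∙y to xy*z≈xz*y; x∙yz≈y∙xz to x*[y*z]≈y*[x*z])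
  open import Relation.Binary.Reasoning.Setoid setoid

  ι-cong : ∀ {p q} → p ≡ q → ι p ≈ ι q
  ι-cong p≡q = reflexive (≡.cong ι p≡q)

  ιℕ : ℕ → Carrier
  ιℕ n = ι (ℕ→ℚ n)

  ιℕ-+ : ∀ m n → ιℕ (m ℕ.+ n) ≈ ιℕ m + ιℕ n
  ιℕ-+ m n = trans (ι-cong (ℕ→ℚ-+ m n)) (+-homo (ℕ→ℚ m) (ℕ→ℚ n))

  ιℕ-*-inv1+ : ∀ n → ιℕ (suc n) * inv1+ n ≈ 1#
  ιℕ-*-inv1+ n = trans (sym (*-homo _ _)) (trans (ι-cong (ℕ→ℚ-*-inverse n)) 1#-homo)

  ιℕ-cong : ∀ {m n} → m ≡ n → ιℕ m ≈ ιℕ n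
  ιℕ-cong m≡n = ι-cong (≡.cong ℕ→ℚ m≡n)

  binom-pascal : ∀ m k → binom (suc m) (suc k) ≈ binom m k + binom m (suc k)
  binom-pascal m k = trans (ιℕ-cong (≡.sym (nCk+nC[k+1]≡[n+1]C[k+1] m k))) (ιℕ-+ (m C k) (m C suc k))

  binom[m,0]≈1 : ∀ m → binom m 0 ≈ 1#
  binom[m,0]≈1 m = 1#-homo

  binom[m,m]≈1 : ∀ m → binom m m ≈ 1#
  binom[m,m]≈1 m = trans (ιℕ-cong (nCn≡1 m)) 1#-homo

  binom[m,1+m]≈0 : ∀ m → binom m (suc m) ≈ 0#
  binom[m,1+m]≈0 m = trans (ιℕ-cong (nC[1+n]≡0 m)) 0#-homo

  pow-+ : ∀ z m n → pow z (m ℕ.+ n) ≈ pow z m * pow z n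
  pow-+ z zero    n = sym (*-identityˡ _)
  pow-+ z (suc m) n = trans (*-congˡ (pow-+ z m n)) (sym (*-assoc _ _ _))

  pow-1# : ∀ n → pow 1# n ≈ 1#
  pow-1# zero    = refl
  pow-1# (suc n) = trans (*-identityˡ _) (pow-1# n)

  ∑ : ℕ → (ℕ → Carrier) → Carrier
  ∑ n f = List.foldr _+_ 0# (List.applyUpTo f n)

  Σ<≈∑ : ∀ n f → Σ< n f ≈ ∑ n f
  Σ<≈∑ n f = reflexive (≡.cong (List.foldr _+_ 0#) (ListP.map-upTo f n))

  ∑-cong< : ∀ n {f g} → (∀ j → j < n → f j ≈ g j) → ∑ n f ≈ ∑ n g
  ∑-cong< zero    f≈g = refl
  ∑-cong< (suc n) f≈g = +-cong (f≈g 0 (s≤s z≤n)) (∑-cong< n (λ j j<n → f≈g (suc j) (s≤s j<n)))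

  ∑-cong : ∀ n {f g} → (∀ j → f j ≈ g j) → ∑ n f ≈ ∑ n g
  ∑-cong n f≈g = ∑-cong< n (λ j _ → f≈g j)

  ∑-+ : ∀ n f g → ∑ n (λ j → f j + g j) ≈ ∑ n f + ∑ n g
  ∑-+ zero    f g = sym (+-identityʳ 0#)
  ∑-+ (suc n) f g = trans (+-congˡ (∑-+ n (f ∘ suc) (g ∘ suc))) (+-interchange _ _ _ _)

  *-distribˡ-∑ : ∀ n a f → ∑ n (λ j → a * f j) ≈ a * ∑ n f
  *-distribˡ-∑ zero    a f = sym (zeroʳ a)
  *-distribˡ-∑ (suc n) a f = trans (+-congˡ (*-distribˡ-∑ n a (f ∘ suc))) (sym (distribˡ a _ _))

  ∑-suc : ∀ n f → ∑ (suc n) f ≈ ∑ n f + f n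
  ∑-suc zero    f = +-comm _ _
  ∑-suc (suc n) f = trans (+-congˡ (∑-suc n (f ∘ suc))) (sym (+-assoc _ _ _))

  ∑-reverse : ∀ n f → ∑ (suc n) f ≈ ∑ (suc n) (λ k → f (n ∸ k))
  ∑-reverse zero    f = refl
  ∑-reverse (suc n) f = begin
    f 0 + ∑ (suc n) (f ∘ suc)                     ≈⟨ +-congˡ (∑-reverse n (f ∘ suc)) ⟩
    f 0 + ∑ (suc n) (λ k → f (suc (n ∸ k)))       ≈⟨ +-comm _ _ ⟩
    ∑ (suc n) (λ k → f (suc (n ∸ k))) + f 0       ≈⟨ +-cong (∑-cong< (suc n) reindex) (f-cong (ℕP.n∸n≡0 n)) ⟨
    ∑ (suc n) (λ k → f (suc n ∸ k)) + f (n ∸ n)   ≈⟨ ∑-suc (suc n) (λ k → f (suc n ∸ k)) ⟨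
    ∑ (suc (suc n)) (λ k → f (suc n ∸ k))         ∎
    where
    f-cong : ∀ {i j} → i ≡ j → f i ≈ f j
    f-cong i≡j = reflexive (≡.cong f i≡j)

    reindex : ∀ k → k < suc n → f (suc n ∸ k) ≈ f (suc (n ∸ k))
    reindex k k<1+n = f-cong (ℕP.+-∸-assoc 1 (s≤s⁻¹ k<1+n))

  -- appell a m z = Σ_j C(m,j) a_j z^{m-j} (appell≈∑); the recursion is Pascal's rule.
  appell : (ℕ → Carrier) → ℕ → Carrier → Carrier
  appell a zero    z = a 0
  appell a (suc m) z = z * appell a m z + appell (a ∘ suc) m z

  appellTerm : ℕ → (ℕ → Carrier) → Carrier → ℕ → Carrier
  appellTerm m a z j = binom m j * a j * pow z (m ∸ j)

  appell-cong : ∀ m z {a b} → (∀ k → a k ≈ b k) → appell a m z ≈ appell b m z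
  appell-cong zero    z a≈b = a≈b 0
  appell-cong (suc m) z a≈b = +-cong (*-congˡ (appell-cong m z a≈b)) (appell-cong m z (a≈b ∘ suc))

  appell-+ₛ : ∀ m z a b → appell (λ k → a k + b k) m z ≈ appell a m z + appell b m z
  appell-+ₛ zero    z a b = refl
  appell-+ₛ (suc m) z a b = begin
    z * appell (λ k → a k + b k) m z + appell (λ k → a (suc k) + b (suc k)) m z
      ≈⟨ +-cong (*-congˡ (appell-+ₛ m z a b)) (appell-+ₛ m z (a ∘ suc) (b ∘ suc)) ⟩
    z * (appell a m z + appell b m z) + (appell (a ∘ suc) m z + appell (b ∘ suc) m z)
      ≈⟨ +-congʳ (distribˡ z _ _) ⟩
    (z * appell a m z + z * appell b m z) + (appell (a ∘ suc) m z + appell (b ∘ suc) m z)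
      ≈⟨ +-interchange _ _ _ _ ⟩
    appell a (suc m) z + appell b (suc m) z
      ∎

  appell-*ₛ : ∀ m z y a → appell (λ k → y * a k) m z ≈ y * appell a m z
  appell-*ₛ zero    z y a = refl
  appell-*ₛ (suc m) z y a = begin
    z * appell (λ k → y * a k) m z + appell (λ k → y * a (suc k)) m z
      ≈⟨ +-cong (*-congˡ (appell-*ₛ m z y a)) (appell-*ₛ m z y (a ∘ suc)) ⟩
    z * (y * appell a m z) + y * appell (a ∘ suc) m z
      ≈⟨ +-congʳ (x*[y*z]≈y*[x*z] z y _) ⟩
    y * (z * appell a m z) + y * appell (a ∘ suc) m z
      ≈⟨ distribˡ y _ _ ⟨
    y * appell a (suc m) z
      ∎

  appell-+ : ∀ m a x y → appell a m (x + y) ≈ appell (λ k → appell a k y) m x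
  appell-+ zero    a x y = refl
  appell-+ (suc m) a x y = begin
    (x + y) * appell a m (x + y) + appell (a ∘ suc) m (x + y)
      ≈⟨ +-cong (*-congˡ (appell-+ m a x y)) (appell-+ m (a ∘ suc) x y) ⟩
    (x + y) * appell A m x + appell A′ m x
      ≈⟨ +-congʳ (distribʳ _ x y) ⟩
    (x * appell A m x + y * appell A m x) + appell A′ m x
      ≈⟨ +-assoc _ _ _ ⟩
    x * appell A m x + (y * appell A m x + appell A′ m x)
      ≈⟨ +-congˡ (+-congʳ (appell-*ₛ m x y A)) ⟨
    x * appell A m x + (appell (λ k → y * A k) m x + appell A′ m x)
      ≈⟨ +-congˡ (appell-+ₛ m x (λ k → y * A k) A′) ⟨
    appell (λ k → appell a k y) (suc m) x
      ∎
    where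
    A A′ : ℕ → Carrier
    A  k = appell a k y
    A′ k = appell (a ∘ suc) k y

  appell≈∑ : ∀ m a z → ∑ (suc m) (appellTerm m a z) ≈ appell a m z
  appell≈∑ zero    a z =
    trans (+-identityʳ _) (trans (*-identityʳ _) (trans (*-congʳ (binom[m,0]≈1 0)) (*-identityˡ _)))
  appell≈∑ (suc m) a z = begin
    appellTerm (suc m) a z 0 + ∑ (suc m) (λ j → binom (suc m) (suc j) * a (suc j) * pow z (m ∸ j))
      ≈⟨ +-congˡ (∑-cong (suc m) (λ j → trans (*-congʳ (*-congʳ (binom-pascal m j))) (split j))) ⟩
    appellTerm (suc m) a z 0 + ∑ (suc m) (λ j → appellTerm m (a ∘ suc) z j + upper j)
      ≈⟨ +-congˡ (∑-+ (suc m) (appellTerm m (a ∘ suc) z) upper) ⟩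
    appellTerm (suc m) a z 0 + (∑ (suc m) (appellTerm m (a ∘ suc) z) + ∑ (suc m) upper)
      ≈⟨ x+[y+z]≈[x+z]+y _ _ _ ⟩
    (appellTerm (suc m) a z 0 + ∑ (suc m) upper) + ∑ (suc m) (appellTerm m (a ∘ suc) z)
      ≈⟨ +-cong upper-sum (appell≈∑ m (a ∘ suc) z) ⟩
    z * appell a m z + appell (a ∘ suc) m z
      ∎
    where
    upper : ℕ → Carrier
    upper j = binom m (suc j) * a (suc j) * pow z (m ∸ j)

    split : ∀ j → (binom m j + binom m (suc j)) * a (suc j) * pow z (m ∸ j)
                  ≈ appellTerm m (a ∘ suc) z j + upper j
    split j = trans (*-congʳ (distribʳ _ _ _)) (distribʳ _ _ _)

    pull-z : ∀ b p → b * (z * p) ≈ z * (b * p)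
    pull-z b p = x*[y*z]≈y*[x*z] b z p

    upper≈z*term : ∀ j → j < m → upper j ≈ z * appellTerm m a z (suc j)
    upper≈z*term j j<m = trans (*-congˡ (reflexive (≡.cong (pow z) (ℕP.+-∸-assoc 1 j<m)))) (pull-z _ _)

    upper-last : upper m ≈ 0#
    upper-last = trans (*-congʳ (trans (*-congʳ (binom[m,1+m]≈0 m)) (zeroˡ _))) (zeroˡ _)

    upper-sum : appellTerm (suc m) a z 0 + ∑ (suc m) upper ≈ z * appell a m z
    upper-sum = begin
      appellTerm (suc m) a z 0 + ∑ (suc m) upper
        ≈⟨ +-congˡ (∑-suc m upper) ⟩
      appellTerm (suc m) a z 0 + (∑ m upper + upper m)
        ≈⟨ +-congˡ (trans (+-congˡ upper-last) (+-identityʳ _)) ⟩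
      appellTerm (suc m) a z 0 + ∑ m upper
        ≈⟨ +-cong (pull-z _ _) (∑-cong< m upper≈z*term) ⟩
      z * appellTerm m a z 0 + ∑ m (λ j → z * appellTerm m a z (suc j))
        ≈⟨ *-distribˡ-∑ (suc m) z (appellTerm m a z) ⟩
      z * ∑ (suc m) (appellTerm m a z)
        ≈⟨ *-congˡ (appell≈∑ m a z) ⟩
      z * appell a m z
        ∎

  δ₀ δ₁ : ℕ → Carrier
  δ₀ zero    = 1#
  δ₀ (suc _) = 0#
  δ₁ zero    = 0#
  δ₁ (suc k) = δ₀ k

  appell-0 : ∀ m z → appell (λ _ → 0#) m z ≈ 0#
  appell-0 zero    z = refl
  appell-0 (suc m) z =
    trans (+-cong (*-congˡ (appell-0 m z)) (appell-0 m z)) (trans (+-identityʳ _) (zeroʳ z))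

  appell-δ₀ : ∀ m z → appell δ₀ m z ≈ pow z m
  appell-δ₀ zero    z = refl
  appell-δ₀ (suc m) z = trans (+-cong (*-congˡ (appell-δ₀ m z)) (appell-0 m z)) (+-identityʳ _)

  appell-δ₁ : ∀ n z → appell δ₁ (suc n) z ≈ ιℕ (suc n) * pow z n
  appell-δ₁ zero    z =
    trans (+-congʳ (zeroʳ z)) (trans (+-identityˡ _) (sym (trans (*-congʳ 1#-homo) (*-identityˡ _))))
  appell-δ₁ (suc n) z = begin
    z * appell δ₁ (suc n) z + appell δ₀ (suc n) z
      ≈⟨ +-cong (*-congˡ (appell-δ₁ n z)) (appell-δ₀ (suc n) z) ⟩
    z * (ιℕ (suc n) * pow z n) + z * pow z n
      ≈⟨ +-cong (x*[y*z]≈y*[x*z] z _ _) (sym (*-identityˡ _)) ⟩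
    ιℕ (suc n) * pow z (suc n) + 1# * pow z (suc n)
      ≈⟨ distribʳ _ _ _ ⟨
    (ιℕ (suc n) + 1#) * pow z (suc n)
      ≈⟨ *-congʳ (trans (ιℕ-+ 1 (suc n)) (trans (+-congʳ 1#-homo) (+-comm _ _))) ⟨
    ιℕ (suc (suc n)) * pow z (suc n)
      ∎

  β : ℕ → Carrier
  β k = ι (bernoulli k)

  bernoulliPoly≈appell : ∀ m z → bernoulliPoly m z ≈ appell β m z
  bernoulliPoly≈appell m z = trans (Σ<≈∑ (suc m) (appellTerm m β z)) (appell≈∑ m β z)

  ι-sumℚ-tabulate : ∀ n (F : Fin n → ℚ) g → (∀ j → ι (F j) ≈ g (toℕ j)) →
                    ι (sumℚ (List.tabulate F)) ≈ ∑ n g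
  ι-sumℚ-tabulate zero    F g F≈g = 0#-homo
  ι-sumℚ-tabulate (suc n) F g F≈g =
    trans (+-homo _ _)
          (+-cong (F≈g Fin.zero) (ι-sumℚ-tabulate n (F ∘ Fin.suc) (g ∘ suc) (F≈g ∘ Fin.suc)))

  bernoulli-recurrence : ∀ k → ∑ (suc (suc k)) (λ j → binom (suc (suc k)) j * β j) ≈ 0#
  bernoulli-recurrence k = begin
    ∑ (suc (suc k)) term
      ≈⟨ ∑-suc (suc k) term ⟩
    S + binom (suc (suc k)) (suc k) * β (suc k)
      ≈⟨ +-congˡ (*-cong (ιℕ-cong ([1+n]Cn≡1+n (suc k))) β[1+k]) ⟩
    S + ιℕ (suc (suc k)) * - (inv1+ (suc k) * S)
      ≈⟨ +-congˡ (-‿distribʳ-* _ _) ⟨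
    S + - (ιℕ (suc (suc k)) * (inv1+ (suc k) * S))
      ≈⟨ +-congˡ (-‿cong (trans (sym (*-assoc _ _ _)) (*-congʳ (ιℕ-*-inv1+ (suc k))))) ⟩
    S + - (1# * S)
      ≈⟨ +-congˡ (-‿cong (*-identityˡ S)) ⟩
    S + - S
      ≈⟨ -‿inverseʳ S ⟩
    0#
      ∎
    where
    term : ℕ → Carrier
    term j = binom (suc (suc k)) j * β j

    S : Carrier
    S = ∑ (suc k) term

    summand : Fin (suc k) → ℚ
    summand j = ℕ→ℚ (suc (suc k) C toℕ j) ℚ.* lookup (Bs k) j

    ι-sum : ι (sumℚ (List.map summand (List.allFin (suc k)))) ≈ S
    ι-sum = trans (ι-cong (≡.cong sumℚ (ListP.map-tabulate (λ j → j) summand)))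
      (ι-sumℚ-tabulate (suc k) summand term
        (λ j → trans (*-homo _ _) (*-congˡ (ι-cong (lookup-Bs k j)))))

    β[1+k] : β (suc k) ≈ - (inv1+ (suc k) * S)
    β[1+k] = trans (ι-cong (bernoulli-suc k))
                   (trans (-‿homo _) (-‿cong (trans (*-homo _ _) (*-congˡ ι-sum))))

  bernoulli-binomial-sum : ∀ k → ∑ (suc k) (λ j → binom k j * β j) ≈ δ₁ k + β k
  bernoulli-binomial-sum zero = begin
    binom 0 0 * β 0 + 0#  ≈⟨ +-identityʳ _ ⟩
    binom 0 0 * β 0       ≈⟨ *-congʳ (binom[m,0]≈1 0) ⟩
    1# * β 0              ≈⟨ *-identityˡ _ ⟩
    β 0                   ≈⟨ +-identityˡ _ ⟨
    0# + β 0              ∎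
  bernoulli-binomial-sum (suc zero) =
    +-cong (trans (*-cong (binom[m,0]≈1 1) 1#-homo) (*-identityˡ 1#))
           (trans (+-identityʳ _) (trans (*-congʳ (binom[m,m]≈1 1)) (*-identityˡ _)))
  bernoulli-binomial-sum (suc (suc k)) =
    trans (∑-suc (suc (suc k)) (λ j → binom (suc (suc k)) j * β j))
          (+-cong (bernoulli-recurrence k)
                  (trans (*-congʳ (binom[m,m]≈1 (suc (suc k)))) (*-identityˡ _)))

  appell-β-1# : ∀ k → appell β k 1# ≈ δ₁ k + β k
  appell-β-1# k = begin
    appell β k 1#                      ≈⟨ appell≈∑ k β 1# ⟨
    ∑ (suc k) (appellTerm k β 1#)      ≈⟨ ∑-cong (suc k) drop-power ⟩
    ∑ (suc k) (λ j → binom k j * β j)  ≈⟨ bernoulli-binomial-sum k ⟩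
    δ₁ k + β k                         ∎
    where
    drop-power : ∀ j → appellTerm k β 1# j ≈ binom k j * β j
    drop-power j = trans (*-congˡ (pow-1# (k ∸ j))) (*-identityʳ _)

  bernoulliPoly-difference : ∀ n z →
    bernoulliPoly (suc n) (z + 1#) ≈ bernoulliPoly (suc n) z + ιℕ (suc n) * pow z n
  bernoulliPoly-difference n z = begin
    bernoulliPoly (suc n) (z + 1#)
      ≈⟨ bernoulliPoly≈appell (suc n) (z + 1#) ⟩
    appell β (suc n) (z + 1#)
      ≈⟨ appell-+ (suc n) β z 1# ⟩
    appell (λ k → appell β k 1#) (suc n) z
      ≈⟨ appell-cong (suc n) z appell-β-1# ⟩
    appell (λ k → δ₁ k + β k) (suc n) z
      ≈⟨ appell-+ₛ (suc n) z δ₁ β ⟩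
    appell δ₁ (suc n) z + appell β (suc n) z
      ≈⟨ +-cong (appell-δ₁ n z) (sym (bernoulliPoly≈appell (suc n) z)) ⟩
    ιℕ (suc n) * pow z n + bernoulliPoly (suc n) z
      ≈⟨ +-comm _ _ ⟩
    bernoulliPoly (suc n) z + ιℕ (suc n) * pow z n
      ∎

  bernoulliPoly-shift : ∀ n z →
    bernoulliPoly (suc n) (z + 1#) * inv1+ n ≈ bernoulliPoly (suc n) z * inv1+ n + pow z n
  bernoulliPoly-shift n z = begin
    bernoulliPoly (suc n) (z + 1#) * inv1+ n
      ≈⟨ *-congʳ (bernoulliPoly-difference n z) ⟩
    (bernoulliPoly (suc n) z + ιℕ (suc n) * pow z n) * inv1+ n
      ≈⟨ distribʳ _ _ _ ⟩
    bernoulliPoly (suc n) z * inv1+ n + ιℕ (suc n) * pow z n * inv1+ n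
      ≈⟨ +-congˡ (xy*z≈xz*y _ _ _) ⟩
    bernoulliPoly (suc n) z * inv1+ n + ιℕ (suc n) * inv1+ n * pow z n
      ≈⟨ +-congˡ (trans (*-congʳ (ιℕ-*-inv1+ n)) (*-identityˡ _)) ⟩
    bernoulliPoly (suc n) z * inv1+ n + pow z n
      ∎

  bernoulliPoly-+ : ∀ m x y →
    ∑ (suc m) (λ k → binom m k * pow x k * bernoulliPoly (m ∸ k) y) ≈ bernoulliPoly m (x + y)
  bernoulliPoly-+ m x y = begin
    ∑ (suc m) (λ k → binom m k * pow x k * bernoulliPoly (m ∸ k) y)
      ≈⟨ ∑-reverse m (λ k → binom m k * pow x k * bernoulliPoly (m ∸ k) y) ⟩
    ∑ (suc m) (λ j → binom m (m ∸ j) * pow x (m ∸ j) * bernoulliPoly (m ∸ (m ∸ j)) y)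
      ≈⟨ ∑-cong< (suc m) reindex ⟩
    ∑ (suc m) (appellTerm m (λ j → bernoulliPoly j y) x)
      ≈⟨ appell≈∑ m _ x ⟩
    appell (λ j → bernoulliPoly j y) m x
      ≈⟨ appell-cong m x (λ j → bernoulliPoly≈appell j y) ⟩
    appell (λ j → appell β j y) m x
      ≈⟨ appell-+ m β x y ⟨
    appell β m (x + y)
      ≈⟨ bernoulliPoly≈appell m (x + y) ⟨
    bernoulliPoly m (x + y)
      ∎
    where
    reindex : ∀ j → j < suc m →
              binom m (m ∸ j) * pow x (m ∸ j) * bernoulliPoly (m ∸ (m ∸ j)) y
              ≈ appellTerm m (λ i → bernoulliPoly i y) x j
    reindex j j<1+m = trans
      (*-cong (*-congʳ (ιℕ-cong (≡.sym (nCk≡nC[n∸k] j≤m))))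
              (reflexive (≡.cong (λ i → bernoulliPoly i y) (ℕP.m∸[m∸n]≡n j≤m))))
      (xy*z≈xz*y _ _ _)
      where j≤m = s≤s⁻¹ j<1+m

theorem5 : {c ℓ : Level} (R : CommutativeRing c ℓ)
    (ι : ℚ → CommutativeRing.Carrier R)
    (ι-hom : IsRingHomomorphism ℚ.+-*-rawRing (CommutativeRing.rawRing R) ι)
    (n₁ n₂ : ℕ) (z₁ z₂ : CommutativeRing.Carrier R) →
    let open CommutativeRing R
        open QAlgebra R ι ι-hom
    in zeta2 n₁ n₂ (z₁ + 1#) z₂
       ≈ zeta2 n₁ n₂ z₁ z₂
         + sgn (Data.Nat._+_ n₁ n₂) * inv1+ n₂ * pow z₁ n₁ * bernoulliPoly (suc n₂) (z₁ + z₂)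
theorem5 R ι ι-hom n₁ n₂ z₁ z₂ = begin
  s * i * Σ< (suc m) (summand (z₁ + 1#))
    ≈⟨ *-congˡ (Σ<≈∑ (suc m) (summand (z₁ + 1#))) ⟩
  s * i * ∑ (suc m) (summand (z₁ + 1#))
    ≈⟨ *-congˡ (∑-cong (suc m) summand-shift) ⟩
  s * i * ∑ (suc m) (λ k → summand z₁ k + P * shifted k)
    ≈⟨ *-congˡ (∑-+ (suc m) (summand z₁) (λ k → P * shifted k)) ⟩
  s * i * (∑ (suc m) (summand z₁) + ∑ (suc m) (λ k → P * shifted k))
    ≈⟨ *-congˡ (+-cong (sym (Σ<≈∑ (suc m) (summand z₁)))
                        (trans (*-distribˡ-∑ (suc m) P shifted) (*-congˡ (bernoulliPoly-+ m z₁ z₂)))) ⟩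
  s * i * (Σ< (suc m) (summand z₁) + P * bernoulliPoly m (z₁ + z₂))
    ≈⟨ trans (distribˡ _ _ _) (+-congˡ (sym (*-assoc _ _ _))) ⟩
  s * i * Σ< (suc m) (summand z₁) + s * i * P * bernoulliPoly m (z₁ + z₂)
    ∎
  where
  open CommutativeRing R
  open QAlgebra R ι ι-hom
  open QAlgebraProperties R ι ι-hom
  open import Relation.Binary.Reasoning.Setoid setoid
  open import Algebra.Solver.Ring.NaturalCoefficients.Default commutativeSemiring
    using (solve; _:+_; _:*_; _:=_)

  m : ℕ
  m = suc n₂

  s i P : Carrier
  s = sgn (n₁ ℕ.+ n₂)
  i = inv1+ n₂
  P = pow z₁ n₁

  summand : Carrier → ℕ → Carrier
  summand z k =
    binom m k * (bernoulliPoly (suc (n₁ ℕ.+ k)) z * inv1+ (n₁ ℕ.+ k)) * bernoulliPoly (m ∸ k) z₂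

  shifted : ℕ → Carrier
  shifted k = binom m k * pow z₁ k * bernoulliPoly (m ∸ k) z₂

  summand-shift : ∀ k → summand (z₁ + 1#) k ≈ summand z₁ k + P * shifted k
  summand-shift k = trans
    (*-congʳ (*-congˡ (trans (bernoulliPoly-shift (n₁ ℕ.+ k) z₁) (+-congˡ (pow-+ z₁ n₁ k)))))
    (solve 5 (λ b X p y q → b :* (X :+ p :* y) :* q := b :* X :* q :+ p :* (b :* y :* q)) refl _ _ _ _ _)
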